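{- A set $\mathcal E$ of $n$-cbc is compatible if and only if the directed graph $\mathcal G_n(\mathcal E)$ does not contain a non-empty path from the vertex $0$ to the vertex $0$.
   Context: Fix an alphabet $\mathcal A$ containing distinct letters $a,b$. A code is a set $X\subseteq\mathcal A^*$ such that $x_1\cdots x_t=y_1\cdots y_{t'}$ with $x_i,y_i\in X$ implies $t=t'$ and $x_i=y_i$ for all $i$. Write $[n]=\{0,\dots,n-1\}$ and $u\bmod n$ for the remainder in $[n]$. An $n$-cbc is a set $X\subseteq a^{[n]}ba^{[n]}$ with $|X|=n$ such that $\{a^n\}\cup X$ is a code. For $n$-cbc $X,Y$ and $r\in[n]$, $X\circ_rY=\{a^iba^\ell: a^iba^j\in X, a^kba^\ell\in Y, (j+k)\bmod n=r\}$ (associative). A set $\mathcal E$ of $n$-cbc is compatible if for all $k\ge0$, $X_1,\dots,X_{k+1}\in\mathcal E$ and $r_1,\dots,r_k\in[n]$, the set $X_1\circ_{r_1}X_2\circ_{r_2}\cdots\circ_{r_k}X_{k+1}$ is an $n$-cbc. The graph $\mathcal G_n(\mathcal E)$ has vertex set $[n]$ and an arrow from $k_1$ to $k_2$ if and only if there exist $X\in\mathcal E$ and two different words $a^{i_1}ba^{j_1},a^{i_2}ba^{j_2}\in X$ with $k_1=(i_1-i_2)\bmod n$ and $k_2=(j_2-j_1)\bmod n$. -}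

module Defs where

open import Level using (Level; 0ℓ) renaming (suc to lsuc)
open import Data.Nat using (ℕ; _<_; _+_; _%_; NonZero)
open import Data.Integer using (ℤ; +_; _-_; _%ℕ_)
open import Data.Fin using (Fin)
open import Data.List using (List; []; _∷_; _++_; replicate; concat; foldl; [_])
open import Data.List.Relation.Unary.All using (All)
open import Data.Product using (Σ; ∃; _×_; _,_)
open import Data.Sum using (_⊎_)
open import Relation.Nullary using (¬_)
open import Relation.Binary.PropositionalEquality using (_≡_; _≢_)
open import Relation.Binary.Construct.Closure.Transitive using (TransClosure)
open import Function.Definitions using (Injective)

module Words (A : Set) (a b : A) where

  Word : Set
  Word = List A

  Lang : Set₁
  Lang = Word → Set

  IsCode : Lang → Set
  IsCode X = (xs ys : List Word) → All X xs → All X ys →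
             concat xs ≡ concat ys → xs ≡ ys

  aba : ℕ → ℕ → Word
  aba i j = replicate i a ++ (b ∷ replicate j a)

  HasCard : ℕ → Lang → Set
  HasCard n X = Σ (Fin n → Word) λ f →
                  Injective _≡_ _≡_ f × ((w : Word) → (X w → ∃ λ k → f k ≡ w) × ((∃ λ k → f k ≡ w) → X w))

  InBlock : ℕ → Lang → Set
  InBlock n X = (w : Word) → X w → ∃ λ i → ∃ λ j → i < n × j < n × w ≡ aba i j

  addAn : ℕ → Lang → Lang
  addAn n X w = (w ≡ replicate n a) ⊎ X w

  IsCbc : ℕ → Lang → Set
  IsCbc n X = InBlock n X × HasCard n X × IsCode (addAn n X)

  compose : (n : ℕ) .{{_ : NonZero n}} → Lang → ℕ → Lang → Lang
  compose n X r Y w = ∃ λ i → ∃ λ j → ∃ λ k → ∃ λ l →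
    X (aba i j) × Y (aba k l) × (j + k) % n ≡ r × w ≡ aba i l

  -- X₁ ∘_{r₁} X₂ ∘_{r₂} ⋯ ∘_{r_k} X_{k+1}  (composition is associative;
  -- we bracket to the left)
  composeAll : (n : ℕ) .{{_ : NonZero n}} → Lang → List (ℕ × Lang) → Lang
  composeAll n X₁ rs = foldl (λ acc p → compose n acc (Data.Product.proj₁ p) (Data.Product.proj₂ p)) X₁ rs

  SetOfCbc : ℕ → (Lang → Set) → Set₁
  SetOfCbc n E = (X : Lang) → E X → IsCbc n X

  Compatible : (n : ℕ) .{{_ : NonZero n}} → (Lang → Set) → Set₁
  Compatible n E = (X₁ : Lang) (rs : List (ℕ × Lang)) →
    E X₁ → All (λ p → Data.Product.proj₁ p < n × E (Data.Product.proj₂ p)) rs →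
    IsCbc n (composeAll n X₁ rs)

  -- arrow k₁ → k₂ in G_n(E); vertices are the naturals < n
  Arrow : (n : ℕ) .{{_ : NonZero n}} → (Lang → Set) → ℕ → ℕ → Set₁
  Arrow n E k₁ k₂ = ∃ λ (X : Lang) → E X × (∃ λ i₁ → ∃ λ j₁ → ∃ λ i₂ → ∃ λ j₂ →
    X (aba i₁ j₁) × X (aba i₂ j₂) × aba i₁ j₁ ≢ aba i₂ j₂ ×
    k₁ ≡ (+ i₁ - + i₂) %ℕ n × k₂ ≡ (+ j₂ - + j₁) %ℕ n)

  HasNonemptyCycleAt0 : (n : ℕ) .{{_ : NonZero n}} → (Lang → Set) → Set₁
  HasNonemptyCycleAt0 n E = TransClosure (Arrow n E) 0 0

-- Read the a-runs between consecutive b's of a word modulo n: two factorisations over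
-- {aⁿ} ∪ X (X ⊆ a^[n] b a^[n]) with the same residues agree up to the first place where they
-- differ, and that place starts a path to 0 in 𝒢ₙ({X}).  So if 𝒢ₙ({X}) has no cycle through 0,
-- {aⁿ} ∪ X is a code, and counting residue sequences (m ^ M ≤ n ^ (1 + M) for every M) shows
-- that X has at most n words.
--
-- The words of Z ∘ᵣ X come from the n² chains (z , x) of a word of Z and a word of X, sorted into
-- n classes by r; two different chains of one class give either different words or a cycle
-- through 0.  If 𝒢ₙ(E) has no such cycle, every class therefore yields at most n, hence exactly n,
-- distinct words, and iterated compositions stay n-cbc.  Conversely, a cycle 0 → k₁ → ⋯ → 0 can be
-- followed arrow by arrow inside an iterated composition until its last arrow makes two chains of
-- one class collide; that class then has more than n members while all have at least n,
-- contradicting the total n².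

module Submission where

open import Defs
open import Data.Empty using (⊥; ⊥-elim)
open import Data.Fin using (Fin; zero; suc; toℕ; punchOut)
open import Data.Fin.Properties using (injective⇒≤; punchOut-injective; toℕ-fromℕ<) renaming (_≟_ to _≟ᶠ_)
open import Data.Integer as ℤ using (_%ℕ_)
import Data.Integer.Properties as ℤ
open import Data.Integer.DivMod using (n%ℕd<d)
open import Data.List
  using (List; []; _∷_; _++_; [_]; replicate; concat; length; map; filter; lookup; cartesianProduct; allFin)
open import Data.List.Properties
  using (length-replicate; length-++; length-map; length-tabulate; ++-identityʳ; ++-assoc; concat-++;
         ∷-injectiveˡ; ∷-injectiveʳ; map-injective; filter-accept; filter-reject; foldl-++)
open import Data.List.Relation.Unary.All using (All; []; _∷_)
import Data.List.Relation.Unary.All as All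
import Data.List.Relation.Unary.All.Properties as All
open import Data.List.Relation.Unary.AllPairs using (_∷_)
open import Data.List.Relation.Unary.Any using (index)
open import Data.List.Relation.Unary.Any.Properties using (lookup-index)
open import Data.List.Membership.Propositional.Properties
  using (∈-lookup; ∈-filter⁺; ∈-filter⁻; ∈-cartesianProduct⁺; ∈-allFin)
open import Data.List.Relation.Unary.Unique.Propositional using (Unique)
import Data.List.Relation.Unary.Unique.Propositional.Properties as Unique
open import Data.Nat
  using (ℕ; zero; suc; _+_; _*_; _∸_; _^_; _≤_; _<_; _%_; _/_; z≤n; s≤s; s≤s⁻¹; NonZero; >-nonZero⁻¹)
open import Data.Nat.DivMod
open import Data.Nat.Properties
open import Data.Nat.Solver using (module +-*-Solver)
open import Algebra.Properties.CommutativeSemigroup +-commutativeSemigroup using (xy∙z≈xz∙y; interchange)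
open import Data.Product using (∃; ∃₂; _×_; _,_; proj₁; proj₂; uncurry)
open import Data.Product.Properties using (≡-dec; ×-≡,≡→≡)
open import Data.Sum using (_⊎_; inj₁; inj₂)
open import Data.Vec using (Vec; []; _∷_; toList)
open import Data.Vec.Properties using (toList-injective; cast-is-id)
open import Data.Vec.Recursive using (Fin[m^n]↔Fin[m]^n)
open import Data.Vec.Recursive.Properties using (↔Vec)
open import Function using (_∘_)
open import Function.Bundles using (_↣_; _↔_; Injection; mk↣)
open import Function.Construct.Composition using (_↣-∘_; _↔-∘_)
open import Function.Definitions using (Injective)
open import Function.Properties.Inverse using (↔⇒↣; ↔-sym)
open import Relation.Nullary using (¬_; Dec; yes; no; contradiction)
open import Relation.Binary.PropositionalEquality
  using (_≡_; _≢_; refl; sym; trans; cong; cong₂; subst; subst₂; module ≡-Reasoning)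
open import Relation.Binary.Construct.Closure.Transitive using (TransClosure; _∷_)
  renaming ([_] to [_]⁺; _++_ to _++⁺_)

module Residues (n : ℕ) .{{_ : NonZero n}} where

  infix 4 _≡ₙ_
  infixl 6 _−ₙ_

  _≡ₙ_ : ℕ → ℕ → Set
  x ≡ₙ y = x % n ≡ y % n

  _−ₙ_ : ℕ → ℕ → ℕ
  x −ₙ y = (ℤ.+ x ℤ.- ℤ.+ y) %ℕ n

  ≡ₙ⇒≡ : ∀ {x y} → x < n → y < n → x ≡ₙ y → x ≡ y
  ≡ₙ⇒≡ {x} {y} x<n y<n x≡y = begin
    x      ≡⟨ m<n⇒m%n≡m x<n ⟨
    x % n  ≡⟨ x≡y ⟩
    y % n  ≡⟨ m<n⇒m%n≡m y<n ⟩
    y      ∎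
    where open ≡-Reasoning

  +-congʳ-≡ₙ : ∀ {x y} k → x ≡ₙ y → x + k ≡ₙ y + k
  +-congʳ-≡ₙ {x} {y} k x≡y = begin
    (x + k) % n            ≡⟨ %-distribˡ-+ x k n ⟩
    (x % n + k % n) % n    ≡⟨ cong (λ z → (z + k % n) % n) x≡y ⟩
    (y % n + k % n) % n    ≡⟨ %-distribˡ-+ y k n ⟨
    (y + k) % n            ∎
    where open ≡-Reasoning

  -- adding n ∸ k % n to k yields a multiple of n
  +-cancelʳ-≡ₙ : ∀ {x y} k → x + k ≡ₙ y + k → x ≡ₙ y
  +-cancelʳ-≡ₙ {x} {y} k x+k≡y+k = begin
    x % n                      ≡⟨ [m+kn]%n≡m%n x (suc (k / n)) n ⟨
    (x + suc (k / n) * n) % n  ≡⟨ cong (λ z → (x + z) % n) k+k̅≡ ⟨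
    (x + (k + k̅)) % n          ≡⟨ cong (_% n) (+-assoc x k k̅) ⟨
    (x + k + k̅) % n            ≡⟨ +-congʳ-≡ₙ k̅ x+k≡y+k ⟩
    (y + k + k̅) % n            ≡⟨ cong (_% n) (+-assoc y k k̅) ⟩
    (y + (k + k̅)) % n          ≡⟨ cong (λ z → (y + z) % n) k+k̅≡ ⟩
    (y + suc (k / n) * n) % n  ≡⟨ [m+kn]%n≡m%n y (suc (k / n)) n ⟩
    y % n                      ∎
    where
    open ≡-Reasoning
    k̅ = n ∸ k % n
    k+k̅≡ : k + k̅ ≡ suc (k / n) * n
    k+k̅≡ = begin
      k + k̅                          ≡⟨ cong (_+ k̅) (m≡m%n+[m/n]*n k n) ⟩
      k % n + (k / n) * n + k̅        ≡⟨ +-assoc (k % n) _ k̅ ⟩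
      k % n + ((k / n) * n + k̅)      ≡⟨ cong (k % n +_) (+-comm ((k / n) * n) k̅) ⟩
      k % n + (k̅ + (k / n) * n)      ≡⟨ +-assoc (k % n) k̅ _ ⟨
      k % n + k̅ + (k / n) * n        ≡⟨ cong (_+ (k / n) * n) (m+[n∸m]≡n (m%n≤n k n)) ⟩
      suc (k / n) * n                ∎

  −ₙ<n : ∀ x y → x −ₙ y < n
  −ₙ<n x y = n%ℕd<d (ℤ.+ x ℤ.- ℤ.+ y) n

  x−ₙx≡0 : ∀ x → x −ₙ x ≡ 0
  x−ₙx≡0 x = trans (cong (_%ℕ n) (ℤ.+-inverseʳ (ℤ.+ x))) (m*n%n≡0 0 n)

  -[d]%n≡n∸d : ∀ d → 0 < d → d < n → (ℤ.- ℤ.+ d) %ℕ n ≡ n ∸ d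
  -[d]%n≡n∸d (suc t) _ t<n rewrite m<n⇒m%n≡m t<n = refl

  −ₙ-≥ : ∀ {x y} → y ≤ x → x < n → x −ₙ y ≡ x ∸ y
  −ₙ-≥ {x} {y} y≤x x<n = begin
    (ℤ.+ x ℤ.- ℤ.+ y) %ℕ n  ≡⟨ cong (_%ℕ n) (trans (ℤ.m-n≡m⊖n x y) (ℤ.⊖-≥ y≤x)) ⟩
    (x ∸ y) % n             ≡⟨ m<n⇒m%n≡m (≤-<-trans (m∸n≤m x y) x<n) ⟩
    x ∸ y                   ∎
    where open ≡-Reasoning

  −ₙ-< : ∀ {x y} → x < y → y < n → x −ₙ y ≡ n ∸ (y ∸ x)
  −ₙ-< {x} {y} x<y y<n = begin
    (ℤ.+ x ℤ.- ℤ.+ y) %ℕ n  ≡⟨ cong (_%ℕ n) (trans (ℤ.m-n≡m⊖n x y) (ℤ.⊖-< x<y)) ⟩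
    (ℤ.- ℤ.+ (y ∸ x)) %ℕ n  ≡⟨ -[d]%n≡n∸d (y ∸ x) (m<n⇒0<n∸m x<y) (≤-<-trans (m∸n≤m y x) y<n) ⟩
    n ∸ (y ∸ x)             ∎
    where open ≡-Reasoning

  −ₙ-+ : ∀ {x y} → x < n → y < n → (x −ₙ y) + y ≡ₙ x
  −ₙ-+ {x} {y} x<n y<n with ≤-<-connex y x
  ... | inj₁ y≤x = cong (_% n) (trans (cong (_+ y) (−ₙ-≥ y≤x x<n)) (m∸n+n≡m y≤x))
  ... | inj₂ x<y = begin
    (x −ₙ y + y) % n         ≡⟨ cong (λ z → (z + y) % n) (−ₙ-< x<y y<n) ⟩
    (n ∸ (y ∸ x) + y) % n    ≡⟨ cong (_% n) wrap ⟩
    (x + n) % n              ≡⟨ [m+n]%n≡m%n x n ⟩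
    x % n                    ∎
    where
    open ≡-Reasoning
    wrap : n ∸ (y ∸ x) + y ≡ x + n
    wrap = begin
      n ∸ (y ∸ x) + y               ≡⟨ cong (n ∸ (y ∸ x) +_) (m∸n+n≡m (<⇒≤ x<y)) ⟨
      n ∸ (y ∸ x) + (y ∸ x + x)     ≡⟨ +-assoc (n ∸ (y ∸ x)) _ x ⟨
      n ∸ (y ∸ x) + (y ∸ x) + x     ≡⟨ cong (_+ x) (m∸n+n≡m (≤-trans (m∸n≤m y x) (<⇒≤ y<n))) ⟩
      n + x                         ≡⟨ +-comm n x ⟩
      x + n                         ∎

  −ₙ≡−ₙ⇒≡ₙ : ∀ {x y x′ y′} → x < n → y < n → x′ < n → y′ < n →
             x −ₙ y ≡ x′ −ₙ y′ → x + y′ ≡ₙ x′ + y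
  −ₙ≡−ₙ⇒≡ₙ {x} {y} {x′} {y′} x<n y<n x′<n y′<n d≡d′ = begin
    (x + y′) % n            ≡⟨ +-congʳ-≡ₙ y′ (−ₙ-+ x<n y<n) ⟨
    (x −ₙ y + y + y′) % n   ≡⟨ cong (λ d → (d + y + y′) % n) d≡d′ ⟩
    (x′ −ₙ y′ + y + y′) % n ≡⟨ cong (_% n) (xy∙z≈xz∙y (x′ −ₙ y′) y y′) ⟩
    (x′ −ₙ y′ + y′ + y) % n ≡⟨ +-congʳ-≡ₙ y (−ₙ-+ x′<n y′<n) ⟩
    (x′ + y) % n            ∎
    where open ≡-Reasoning

  ≡ₙ⇒−ₙ≡−ₙ : ∀ {x y x′ y′} → x < n → y < n → x′ < n → y′ < n →
             x + y′ ≡ₙ x′ + y → x −ₙ y ≡ x′ −ₙ y′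
  ≡ₙ⇒−ₙ≡−ₙ {x} {y} {x′} {y′} x<n y<n x′<n y′<n x+y′≡x′+y =
    ≡ₙ⇒≡ (−ₙ<n x y) (−ₙ<n x′ y′) (+-cancelʳ-≡ₙ (y + y′) (begin
      (x −ₙ y + (y + y′)) % n   ≡⟨ cong (_% n) (+-assoc (x −ₙ y) y y′) ⟨
      (x −ₙ y + y + y′) % n     ≡⟨ +-congʳ-≡ₙ y′ (−ₙ-+ x<n y<n) ⟩
      (x + y′) % n              ≡⟨ x+y′≡x′+y ⟩
      (x′ + y) % n              ≡⟨ +-congʳ-≡ₙ y (−ₙ-+ x′<n y′<n) ⟨
      (x′ −ₙ y′ + y′ + y) % n   ≡⟨ cong (_% n) (xy∙z≈xz∙y (x′ −ₙ y′) y′ y) ⟩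
      (x′ −ₙ y′ + y + y′) % n   ≡⟨ cong (_% n) (+-assoc (x′ −ₙ y′) y y′) ⟩
      (x′ −ₙ y′ + (y + y′)) % n ∎))
    where open ≡-Reasoning

  ≡⇒−ₙ≡0 : ∀ {x y} → x ≡ y → x −ₙ y ≡ 0
  ≡⇒−ₙ≡0 {x} refl = x−ₙx≡0 x

  −ₙ≡0⇒≡ : ∀ {x y} → x < n → y < n → x −ₙ y ≡ 0 → x ≡ y
  −ₙ≡0⇒≡ {x} {y} x<n y<n x−ₙy≡0 =
    ≡ₙ⇒≡ x<n y<n (+-cancelʳ-≡ₙ y (−ₙ≡−ₙ⇒≡ₙ x<n y<n y<n y<n (trans x−ₙy≡0 (sym (x−ₙx≡0 y)))))

  +-cancelˡ-≡ₙ : ∀ {x y} k → k + x ≡ₙ k + y → x ≡ₙ y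
  +-cancelˡ-≡ₙ {x} {y} k k+x≡k+y =
    +-cancelʳ-≡ₙ k (trans (cong (_% n) (+-comm x k)) (trans k+x≡k+y (cong (_% n) (+-comm k y))))

sumBelow : ℕ → (ℕ → ℕ) → ℕ
sumBelow zero    f = 0
sumBelow (suc N) f = sumBelow N f + f N

sumBelow-cong : ∀ N {f g} → (∀ r → f r ≡ g r) → sumBelow N f ≡ sumBelow N g
sumBelow-cong zero    f≗g = refl
sumBelow-cong (suc N) f≗g = cong₂ _+_ (sumBelow-cong N f≗g) (f≗g N)

sumBelow-+ : ∀ N f g → sumBelow N (λ r → f r + g r) ≡ sumBelow N f + sumBelow N g
sumBelow-+ zero    f g = refl
sumBelow-+ (suc N) f g =
  trans (cong (_+ (f N + g N)) (sumBelow-+ N f g)) (interchange (sumBelow N f) _ (f N) _)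

sumBelow-const : ∀ N K → sumBelow N (λ _ → K) ≡ N * K
sumBelow-const zero    K = refl
sumBelow-const (suc N) K = trans (cong (_+ K) (sumBelow-const N K)) (+-comm (N * K) K)

sumBelow-mono-≤ : ∀ N {f g} → (∀ r → r < N → f r ≤ g r) → sumBelow N f ≤ sumBelow N g
sumBelow-mono-≤ zero    f≤g = z≤n
sumBelow-mono-≤ (suc N) f≤g =
  +-mono-≤ (sumBelow-mono-≤ N (λ r r<N → f≤g r (m≤n⇒m≤1+n r<N))) (f≤g N ≤-refl)

sumBelow-mono-< : ∀ N {f g r₀} → (∀ r → r < N → f r ≤ g r) → r₀ < N → f r₀ < g r₀ →
                  sumBelow N f < sumBelow N g
sumBelow-mono-< (suc N) {r₀ = r₀} f≤g r₀<1+N fr₀<gr₀ with m≤n⇒m<n∨m≡n (s≤s⁻¹ r₀<1+N)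
... | inj₁ r₀<N = +-mono-<-≤ (sumBelow-mono-< N f≤g′ r₀<N fr₀<gr₀) (f≤g N ≤-refl)
  where f≤g′ = λ r r<N → f≤g r (m≤n⇒m≤1+n r<N)
... | inj₂ refl = +-mono-≤-< (sumBelow-mono-≤ N (λ r r<N → f≤g r (m≤n⇒m≤1+n r<N))) fr₀<gr₀

indicator : ∀ {P : Set} → Dec P → ℕ
indicator (yes _) = 1
indicator (no _)  = 0

sumBelow-indicator-≤ : ∀ {k N} → N ≤ k → sumBelow N (λ r → indicator (k ≟ r)) ≡ 0
sumBelow-indicator-≤ {k} {zero}  _ = refl
sumBelow-indicator-≤ {k} {suc N} 1+N≤k with k ≟ N
... | yes refl = ⊥-elim (<-irrefl refl 1+N≤k)
... | no _     = trans (+-identityʳ _) (sumBelow-indicator-≤ (m+n≤o⇒n≤o 1 1+N≤k))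

sumBelow-indicator : ∀ {k N} → k < N → sumBelow N (λ r → indicator (k ≟ r)) ≡ 1
sumBelow-indicator {k} {suc N} k<1+N with k ≟ N
... | yes refl = cong (_+ 1) (sumBelow-indicator-≤ {k} {k} ≤-refl)
... | no k≢N   = trans (+-identityʳ _) (sumBelow-indicator (≤∧≢⇒< (s≤s⁻¹ k<1+N) k≢N))

module _ {C : Set} (key : C → ℕ) where

  fibre : List C → ℕ → List C
  fibre xs r = filter (λ x → key x ≟ r) xs

  length-fibre-∷ : ∀ x xs r → length (fibre (x ∷ xs) r) ≡ indicator (key x ≟ r) + length (fibre xs r)
  length-fibre-∷ x xs r with key x ≟ r
  ... | yes kx≡r = cong length (filter-accept (λ y → key y ≟ r) kx≡r)
  ... | no  kx≢r = cong length (filter-reject (λ y → key y ≟ r) kx≢r)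

  sumBelow-length-fibre : ∀ N → (∀ x → key x < N) → ∀ xs → sumBelow N (λ r → length (fibre xs r)) ≡ length xs
  sumBelow-length-fibre N key<N []       = trans (sumBelow-const N 0) (*-zeroʳ N)
  sumBelow-length-fibre N key<N (x ∷ xs) = begin
    sumBelow N (λ r → length (fibre (x ∷ xs) r))
      ≡⟨ sumBelow-cong N (length-fibre-∷ x xs) ⟩
    sumBelow N (λ r → indicator (key x ≟ r) + length (fibre xs r))
      ≡⟨ sumBelow-+ N _ _ ⟩
    sumBelow N (λ r → indicator (key x ≟ r)) + sumBelow N (λ r → length (fibre xs r))
      ≡⟨ cong₂ _+_ (sumBelow-indicator (key<N x)) (sumBelow-length-fibre N key<N xs) ⟩
    suc (length xs) ∎
    where open ≡-Reasoning

Unique⇒lookup-injective : ∀ {C : Set} {xs : List C} → Unique xs → Injective _≡_ _≡_ (lookup xs)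
Unique⇒lookup-injective (_ ∷ _) {zero} {zero} _ = refl
Unique⇒lookup-injective (x∉xs ∷ _) {zero} {suc q} eq = ⊥-elim (All.lookup x∉xs (∈-lookup q) eq)
Unique⇒lookup-injective (x∉xs ∷ _) {suc p} {zero} eq = ⊥-elim (All.lookup x∉xs (∈-lookup p) (sym eq))
Unique⇒lookup-injective (_ ∷ xs-unique) {suc p} {suc q} eq =
  cong suc (Unique⇒lookup-injective xs-unique eq)

cover⇒≤ : ∀ {W : Set} {L N} (h : Fin L → W) {f : Fin N → W} → Injective _≡_ _≡_ f →
          (∀ k → ∃ λ p → h p ≡ f k) → N ≤ L
cover⇒≤ h f-injective cover = injective⇒≤ {f = proj₁ ∘ cover} λ {k} {k′} eq →
  f-injective (trans (sym (proj₂ (cover k))) (trans (cong h eq) (proj₂ (cover k′))))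

-- each f k is also hit from an index other than q, so punching q out leaves an injection into Fin (L ∸ 1)
cover-collision⇒< : ∀ {W : Set} {L N} (h : Fin L → W) {f : Fin N → W} → Injective _≡_ _≡_ f →
                    (∀ k → ∃ λ p → h p ≡ f k) → ∀ {q q′} → q ≢ q′ → h q ≡ h q′ → N < L
cover-collision⇒< {L = suc l} {N} h {f} f-injective cover {q} {q′} q≢q′ hq≡hq′ =
  s≤s (injective⇒≤ {f = g} g-injective)
  where
  avoid-q : ∀ k → ∃ λ p → q ≢ p × h p ≡ f k
  avoid-q k with proj₁ (cover k) ≟ᶠ q
  ... | yes p≡q = q′ , q≢q′ , trans (sym hq≡hq′) (trans (cong h (sym p≡q)) (proj₂ (cover k)))
  ... | no  p≢q = proj₁ (cover k) , p≢q ∘ sym , proj₂ (cover k)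
  g : Fin N → Fin l
  g k = punchOut (proj₁ (proj₂ (avoid-q k)))
  g-injective : Injective _≡_ _≡_ g
  g-injective {k} {k′} eq = f-injective (begin
    f k                     ≡⟨ proj₂ (proj₂ (avoid-q k)) ⟨
    h (proj₁ (avoid-q k))   ≡⟨ cong h (punchOut-injective (q≢ k) (q≢ k′) eq) ⟩
    h (proj₁ (avoid-q k′))  ≡⟨ proj₂ (proj₂ (avoid-q k′)) ⟩
    f k′                    ∎)
    where
    open ≡-Reasoning
    q≢ = λ k → proj₁ (proj₂ (avoid-q k))

concatMap⁺ : ∀ {ℓ ℓ′} {R : ℕ → ℕ → Set ℓ} {S : ℕ → ℕ → Set ℓ′} →
             (∀ {x y} → R x y → TransClosure S x y) → ∀ {x y} → TransClosure R x y → TransClosure S x y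
concatMap⁺ f [ r ]⁺    = f r
concatMap⁺ f (r ∷ rs) = f r ++⁺ concatMap⁺ f rs

bernoulli : ∀ n M → n ^ M * (n + M) ≤ n * suc n ^ M
bernoulli n zero = ≤-reflexive (trans (*-identityˡ (n + 0)) (trans (+-identityʳ n) (sym (*-identityʳ n))))
bernoulli n (suc M) = begin
  n ^ suc M * (n + suc M)
    ≡⟨ solve 3 (λ n x M → (n :* x) :* (n :+ (con 1 :+ M)) := n :* (x :* (n :+ M)) :+ n :* x) refl n (n ^ M) M ⟩
  n * (n ^ M * (n + M)) + n * n ^ M
    ≤⟨ +-mono-≤ (*-monoʳ-≤ n (bernoulli n M)) (*-monoʳ-≤ n (^-monoˡ-≤ M (n≤1+n n))) ⟩
  n * (n * suc n ^ M) + n * suc n ^ M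
    ≡⟨ solve 2 (λ n y → n :* (n :* y) :+ n :* y := n :* ((con 1 :+ n) :* y)) refl n (suc n ^ M) ⟩
  n * suc n ^ suc M
    ∎
  where
  open ≤-Reasoning
  open +-*-Solver

-- Bernoulli at M = n², where n ^ M * (n + M) = n * (n ^ M * suc n)
n^[1+n*n]<[1+n]^[n*n] : ∀ n .{{_ : NonZero n}} → n ^ suc (n * n) < suc n ^ (n * n)
n^[1+n*n]<[1+n]^[n*n] n = begin-strict
  n ^ suc (n * n)                 ≡⟨ *-comm n (n ^ (n * n)) ⟩
  n ^ (n * n) * n                 <⟨ m<n+m (n ^ (n * n) * n) (m^n>0 n (n * n)) ⟩
  n ^ (n * n) + n ^ (n * n) * n   ≡⟨ solve 2 (λ x n → x :+ x :* n := x :* (con 1 :+ n)) refl (n ^ (n * n)) n ⟩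
  n ^ (n * n) * suc n             ≤⟨ *-cancelˡ-≤ n (subst (_≤ n * suc n ^ (n * n)) rearranged (bernoulli n (n * n))) ⟩
  suc n ^ (n * n)                 ∎
  where
  open ≤-Reasoning
  open +-*-Solver
  rearranged : n ^ (n * n) * (n + n * n) ≡ n * (n ^ (n * n) * suc n)
  rearranged = solve 2 (λ x n → x :* (n :+ n :* n) := n :* (x :* (con 1 :+ n))) refl (n ^ (n * n)) n

^≤^suc⇒≤ : ∀ {m n} .{{_ : NonZero n}} → (∀ M → m ^ M ≤ n ^ suc M) → m ≤ n
^≤^suc⇒≤ {m} {n} bound with m ≤? n
... | yes m≤n = m≤n
... | no  m≰n = contradiction (bound (n * n)) (<⇒≱ (begin-strict
  n ^ suc (n * n)   <⟨ n^[1+n*n]<[1+n]^[n*n] n ⟩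
  suc n ^ (n * n)   ≤⟨ ^-monoˡ-≤ (n * n) (≰⇒> m≰n) ⟩
  m ^ (n * n)       ∎))
  where open ≤-Reasoning

Fin^↔Vec : ∀ k K → Fin (k ^ K) ↔ Vec (Fin k) K
Fin^↔Vec k K = ↔Vec K ↔-∘ Fin[m^n]↔Fin[m]^n k K

Vec↣Vec⇒^≤^ : ∀ {m n M N} → Vec (Fin m) M ↣ Vec (Fin n) N → m ^ M ≤ n ^ N
Vec↣Vec⇒^≤^ {m} {n} {M} {N} f =
  injective⇒≤ (Injection.injective (↔⇒↣ (↔-sym (Fin^↔Vec n N)) ↣-∘ (f ↣-∘ ↔⇒↣ (Fin^↔Vec m M))))

module WordProperties (A : Set) (a b : A) (a≢b : a ≢ b) where

  open Words A a b

  replicate-injective : ∀ {p q} → replicate p a ≡ replicate q a → p ≡ q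
  replicate-injective {p} {q} eq = begin
    p                        ≡⟨ length-replicate p ⟨
    length (replicate p a)   ≡⟨ cong length eq ⟩
    length (replicate q a)   ≡⟨ length-replicate q ⟩
    q                        ∎
    where open ≡-Reasoning

  replicate-+ : ∀ p q → replicate (p + q) a ≡ replicate p a ++ replicate q a
  replicate-+ zero    q = refl
  replicate-+ (suc p) q = cong (a ∷_) (replicate-+ p q)

  concat-replicate : ∀ c k → concat (replicate c (replicate k a)) ≡ replicate (c * k) a
  concat-replicate zero    k = refl
  concat-replicate (suc c) k =
    trans (cong (replicate k a ++_) (concat-replicate c k)) (sym (replicate-+ k (c * k)))

  NotHeadedByA : Word → Set
  NotHeadedByA w = ∀ {v} → w ≢ a ∷ v

  aᵖ++-injective : ∀ p q {w w′} → NotHeadedByA w → NotHeadedByA w′ →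
                   replicate p a ++ w ≡ replicate q a ++ w′ → p ≡ q × w ≡ w′
  aᵖ++-injective zero    zero    _  _   eq = refl , eq
  aᵖ++-injective zero    (suc q) w  _   eq = ⊥-elim (w eq)
  aᵖ++-injective (suc p) zero    _  w′  eq = ⊥-elim (w′ (sym eq))
  aᵖ++-injective (suc p) (suc q) w  w′  eq with aᵖ++-injective p q w w′ (∷-injectiveʳ eq)
  ... | refl , w≡w′ = refl , w≡w′

  b∷-NotHeadedByA : ∀ w → NotHeadedByA (b ∷ w)
  b∷-NotHeadedByA w eq = a≢b (sym (∷-injectiveˡ eq))

  aba-injective : ∀ {i j i′ j′} → aba i j ≡ aba i′ j′ → i ≡ i′ × j ≡ j′
  aba-injective {i} {j} {i′} {j′} eq
    with aᵖ++-injective i i′ (b∷-NotHeadedByA _) (b∷-NotHeadedByA _) eq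
  ... | i≡i′ , bw≡bw′ = i≡i′ , replicate-injective (∷-injectiveʳ bw≡bw′)

  -- b aᵖ⁰ b aᵖ¹ ⋯ b aᵖᵏ; the leading b makes the encoding injective on all lists
  separate : List ℕ → Word
  separate []       = []
  separate (p ∷ ps) = b ∷ replicate p a ++ separate ps

  separate-NotHeadedByA : ∀ ps → NotHeadedByA (separate ps)
  separate-NotHeadedByA []       ()
  separate-NotHeadedByA (p ∷ ps) = b∷-NotHeadedByA _

  separate-injective : ∀ {ps qs} → separate ps ≡ separate qs → ps ≡ qs
  separate-injective {[]}     {[]}     _  = refl
  separate-injective {p ∷ ps} {q ∷ qs} eq
    with aᵖ++-injective p q (separate-NotHeadedByA ps) (separate-NotHeadedByA qs) (∷-injectiveʳ eq)
  ... | refl , ps≡qs = cong (p ∷_) (separate-injective ps≡qs)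

module Deciphering (A : Set) (a b : A) (a≢b : a ≢ b) (n : ℕ) .{{_ : NonZero n}} where

  open Words A a b
  open WordProperties A a b a≢b
  open Residues n

  0<n : 0 < n
  0<n = >-nonZero⁻¹ n

  InBlock⇒< : ∀ {X i j} → InBlock n X → X (aba i j) → i < n × j < n
  InBlock⇒< {X} {i} {j} X⊆block Xw with X⊆block (aba i j) Xw
  ... | _ , _ , i′<n , j′<n , w≡ with aba-injective w≡
  ...   | refl , refl = i′<n , j′<n

  -- the arrows of 𝒢ₙ({X}); Arrow n E k₁ k₂ unfolds to ∃ λ X → E X × ArrowOf X k₁ k₂
  ArrowOf : Lang → ℕ → ℕ → Set
  ArrowOf X k₁ k₂ = ∃ λ i₁ → ∃ λ j₁ → ∃ λ i₂ → ∃ λ j₂ →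
    X (aba i₁ j₁) × X (aba i₂ j₂) × aba i₁ j₁ ≢ aba i₂ j₂ ×
    k₁ ≡ i₁ −ₙ i₂ × k₂ ≡ j₂ −ₙ j₁

  -- residues of the lengths of the a-runs in a^u · x₁ ⋯ xₖ with xₘ = a^iₘ b a^jₘ
  residues : ℕ → List (ℕ × ℕ) → List ℕ
  residues u []            = u % n ∷ []
  residues u ((i , j) ∷ ps) = (u + i) % n ∷ residues j ps

  _≟²_ : (p q : ℕ × ℕ) → Dec (p ≡ q)
  _≟²_ = ≡-dec _≟_ _≟_

  residues≢[] : ∀ u ps → residues u ps ≢ []
  residues≢[] u []       ()
  residues≢[] u (_ ∷ _)  ()

  divergence-arrow : ∀ {X u v i j i′ j′} → u < n → v < n → i < n → i′ < n →
                     X (aba i j) → X (aba i′ j′) → (i , j) ≢ (i′ , j′) →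
                     u + i ≡ₙ v + i′ → ArrowOf X (v −ₙ u) (j′ −ₙ j)
  divergence-arrow {u = u} {v} {i} {j} {i′} {j′} u<n v<n i<n i′<n Xp Xq p≢q u+i≡v+i′ =
    i , j , i′ , j′ , Xp , Xq , p≢q ∘ ×-≡,≡→≡ ∘ aba-injective ,
    sym (≡ₙ⇒−ₙ≡−ₙ i<n i′<n v<n u<n (trans (cong (_% n) (+-comm i u)) u+i≡v+i′)) , refl

  decipher : ∀ {X} → InBlock n X → ∀ {u v ps qs} → u < n → v < n →
             All (X ∘ uncurry aba) ps → All (X ∘ uncurry aba) qs →
             residues u ps ≡ residues v qs →
             (u ≡ v × ps ≡ qs) ⊎ TransClosure (ArrowOf X) (v −ₙ u) 0
  decipher _ {ps = []} {[]} u<n v<n _ _ eq =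
    inj₁ (≡ₙ⇒≡ u<n v<n (∷-injectiveˡ eq) , refl)
  decipher _ {ps = []} {q ∷ qs} _ _ _ _ eq =
    ⊥-elim (residues≢[] (proj₂ q) qs (sym (∷-injectiveʳ eq)))
  decipher _ {ps = p ∷ ps} {[]} _ _ _ _ eq =
    ⊥-elim (residues≢[] (proj₂ p) ps (∷-injectiveʳ eq))
  decipher {X} X⊆block {u} {v} {(i , j) ∷ ps} {(i′ , j′) ∷ qs} u<n v<n (Xp ∷ Xps) (Xq ∷ Xqs) eq
    with InBlock⇒< X⊆block Xp | InBlock⇒< X⊆block Xq | (i , j) ≟² (i′ , j′)
  ... | i<n , j<n | i′<n , j′<n | yes refl
    with ≡ₙ⇒≡ u<n v<n (+-cancelʳ-≡ₙ i (∷-injectiveˡ eq))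
       | decipher X⊆block j<n j′<n Xps Xqs (∷-injectiveʳ eq)
  ...   | refl | inj₁ (_ , refl) = inj₁ (refl , refl)
  ...   | refl | inj₂ path =
    inj₂ (subst (λ k → TransClosure (ArrowOf X) k 0) (trans (x−ₙx≡0 j) (sym (x−ₙx≡0 u))) path)
  decipher {X} X⊆block {u} {v} {(i , j) ∷ ps} {(i′ , j′) ∷ qs} u<n v<n (Xp ∷ Xps) (Xq ∷ Xqs) eq
      | i<n , j<n | i′<n , j′<n | no p≢q
    with divergence-arrow {X} u<n v<n i<n i′<n Xp Xq p≢q (∷-injectiveˡ eq)
       | decipher X⊆block j<n j′<n Xps Xqs (∷-injectiveʳ eq)
  ...   | arrow | inj₁ (refl , _) = inj₂ [ subst (ArrowOf X (v −ₙ u)) (x−ₙx≡0 j) arrow ]⁺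
  ...   | arrow | inj₂ path = inj₂ (arrow ∷ path)

  -- (c , i , j) stands for (aⁿ)ᶜ · a^i b a^j
  Block : Set
  Block = ℕ × ℕ × ℕ

  blockWords : List Block → ℕ → List Word
  blockWords []                 e = replicate e (replicate n a)
  blockWords ((c , i , j) ∷ ts) e = replicate c (replicate n a) ++ aba i j ∷ blockWords ts e

  factorise : ∀ {X} → InBlock n X → ∀ {xs} → All (addAn n X) xs →
              ∃ λ ts → ∃ λ e → All (X ∘ uncurry aba ∘ proj₂) ts × blockWords ts e ≡ xs
  factorise X⊆block [] = [] , 0 , [] , refl
  factorise X⊆block (inj₁ refl ∷ Fxs) with factorise X⊆block Fxs
  ... | []             , e , []        , eq = [] , suc e , [] , cong (replicate n a ∷_) eq
  ... | (c , ij) ∷ ts , e , Xij ∷ Xts , eq =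
    (suc c , ij) ∷ ts , e , Xij ∷ Xts , cong (replicate n a ∷_) eq
  factorise X⊆block (inj₂ Xx ∷ Fxs) with X⊆block _ Xx | factorise X⊆block Fxs
  ... | i , j , _ , _ , refl | ts , e , Xts , eq = (0 , i , j) ∷ ts , e , Xx ∷ Xts , cong (aba i j ∷_) eq

  gaps : ℕ → List Block → ℕ → List ℕ
  gaps u []                 e = u + e * n ∷ []
  gaps u ((c , i , j) ∷ ts) e = u + c * n + i ∷ gaps j ts e

  separate-gaps : ∀ u ts e → b ∷ replicate u a ++ concat (blockWords ts e) ≡ separate (gaps u ts e)
  separate-gaps u [] e = cong (b ∷_) (begin
    replicate u a ++ concat (replicate e (replicate n a)) ≡⟨ cong (replicate u a ++_) (concat-replicate e n) ⟩
    replicate u a ++ replicate (e * n) a                  ≡⟨ replicate-+ u (e * n) ⟨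
    replicate (u + e * n) a                               ≡⟨ ++-identityʳ _ ⟨
    replicate (u + e * n) a ++ []                         ∎)
    where open ≡-Reasoning
  separate-gaps u ((c , i , j) ∷ ts) e = cong (b ∷_) (begin
    aᵘ ++ concat (replicate c aⁿ ++ aba i j ∷ blockWords ts e)
      ≡⟨ cong (aᵘ ++_) (concat-++ (replicate c aⁿ) (aba i j ∷ blockWords ts e)) ⟨
    aᵘ ++ (concat (replicate c aⁿ) ++ (aba i j ++ rest))
      ≡⟨ cong (λ w → aᵘ ++ (w ++ (aba i j ++ rest))) (concat-replicate c n) ⟩
    aᵘ ++ (replicate (c * n) a ++ ((replicate i a ++ b ∷ replicate j a) ++ rest))
      ≡⟨ cong (λ w → aᵘ ++ (replicate (c * n) a ++ w)) (++-assoc (replicate i a) _ rest) ⟩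
    aᵘ ++ (replicate (c * n) a ++ (replicate i a ++ b ∷ replicate j a ++ rest))
      ≡⟨ ++-assoc aᵘ (replicate (c * n) a) _ ⟨
    (aᵘ ++ replicate (c * n) a) ++ (replicate i a ++ b ∷ replicate j a ++ rest)
      ≡⟨ ++-assoc (aᵘ ++ replicate (c * n) a) (replicate i a) _ ⟨
    ((aᵘ ++ replicate (c * n) a) ++ replicate i a) ++ b ∷ replicate j a ++ rest
      ≡⟨ cong (λ w → (w ++ replicate i a) ++ b ∷ replicate j a ++ rest) (replicate-+ u (c * n)) ⟨
    (replicate (u + c * n) a ++ replicate i a) ++ b ∷ replicate j a ++ rest
      ≡⟨ cong (_++ b ∷ replicate j a ++ rest) (replicate-+ (u + c * n) i) ⟨
    replicate (u + c * n + i) a ++ b ∷ replicate j a ++ rest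
      ≡⟨ cong (replicate (u + c * n + i) a ++_) (separate-gaps j ts e) ⟩
    replicate (u + c * n + i) a ++ separate (gaps j ts e) ∎)
    where
    open ≡-Reasoning
    aᵘ = replicate u a
    aⁿ = replicate n a
    rest = concat (blockWords ts e)

  residues-gaps : ∀ u ts e → map (_% n) (gaps u ts e) ≡ residues u (map proj₂ ts)
  residues-gaps u [] e = cong (_∷ []) ([m+kn]%n≡m%n u e n)
  residues-gaps u ((c , i , j) ∷ ts) e = cong₂ _∷_ head≡ (residues-gaps j ts e)
    where
    head≡ : (u + c * n + i) % n ≡ (u + i) % n
    head≡ = trans (cong (_% n) (xy∙z≈xz∙y u (c * n) i)) ([m+kn]%n≡m%n (u + i) c n)

  gaps-injective : ∀ u ts ts′ e e′ → gaps u ts e ≡ gaps u ts′ e′ →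
                   map proj₂ ts ≡ map proj₂ ts′ → ts ≡ ts′ × e ≡ e′
  gaps-injective u []  []  e e′ eq _ =
    refl , *-cancelʳ-≡ e e′ n (+-cancelˡ-≡ u _ _ (∷-injectiveˡ eq))
  gaps-injective u ((c , i , j) ∷ ts) ((c′ , i′ , j′) ∷ ts′) e e′ eq ij≡
    with ∷-injectiveˡ ij≡
  ... | refl with gaps-injective j ts ts′ e e′ (∷-injectiveʳ eq) (∷-injectiveʳ ij≡)
  ...   | refl , refl = cong (λ c → (c , i , j) ∷ ts) c≡c′ , refl
    where
    c≡c′ : c ≡ c′
    c≡c′ = *-cancelʳ-≡ c c′ n (+-cancelˡ-≡ u _ _ (+-cancelʳ-≡ _ _ _ (∷-injectiveˡ eq)))

  isCode-addAn : ∀ {X} → InBlock n X → ¬ TransClosure (ArrowOf X) 0 0 → IsCode (addAn n X)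
  isCode-addAn {X} X⊆block acyclic xs ys Fxs Fys concat≡
    with factorise X⊆block Fxs | factorise X⊆block Fys
  ... | ts , e , Xts , refl | ts′ , e′ , Xts′ , refl =
    cong₂ blockWords (proj₁ same) (proj₂ same)
    where
    gaps≡ : gaps 0 ts e ≡ gaps 0 ts′ e′
    gaps≡ = separate-injective (begin
      separate (gaps 0 ts e)          ≡⟨ separate-gaps 0 ts e ⟨
      b ∷ concat (blockWords ts e)    ≡⟨ cong (b ∷_) concat≡ ⟩
      b ∷ concat (blockWords ts′ e′)  ≡⟨ separate-gaps 0 ts′ e′ ⟩
      separate (gaps 0 ts′ e′)        ∎)
      where open ≡-Reasoning
    residues≡ : residues 0 (map proj₂ ts) ≡ residues 0 (map proj₂ ts′)
    residues≡ = trans (sym (residues-gaps 0 ts e))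
                      (trans (cong (map (_% n)) gaps≡) (residues-gaps 0 ts′ e′))
    exponents≡ : map proj₂ ts ≡ map proj₂ ts′
    exponents≡ with decipher X⊆block 0<n 0<n (All.map⁺ Xts) (All.map⁺ Xts′) residues≡
    ... | inj₁ (_ , eq) = eq
    ... | inj₂ cycle = ⊥-elim (acyclic (subst (λ k → TransClosure (ArrowOf X) k 0) (x−ₙx≡0 0) cycle))
    same = gaps-injective 0 ts ts′ e e′ gaps≡ exponents≡

  -- encode is injective by decipher, so m ^ M ≤ n ^ (1 + M) for all M
  kraft : ∀ {Y m} → InBlock n Y → ¬ TransClosure (ArrowOf Y) 0 0 →
          (f : Fin m → Word) → Injective _≡_ _≡_ f → (∀ k → Y (f k)) → m ≤ n
  kraft {Y} {m} Y⊆block acyclic f f-injective Yf =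
    ^≤^suc⇒≤ (λ M → Vec↣Vec⇒^≤^ (mk↣ (encode-injective {M})))
    where
    exponents : Fin m → ℕ × ℕ
    exponents k = proj₁ (Y⊆block (f k) (Yf k)) , proj₁ (proj₂ (Y⊆block (f k) (Yf k)))

    f≡aba : ∀ k → f k ≡ uncurry aba (exponents k)
    f≡aba k = proj₂ (proj₂ (proj₂ (proj₂ (Y⊆block (f k) (Yf k)))))

    exponents-injective : Injective _≡_ _≡_ exponents
    exponents-injective {k} {k′} eq =
      f-injective (trans (f≡aba k) (trans (cong (uncurry aba) eq) (sym (f≡aba k′))))

    all-in-Y : ∀ ks → All (Y ∘ uncurry aba) (map exponents ks)
    all-in-Y ks = All.map⁺ (All.universal (λ k → subst Y (f≡aba k) (Yf k)) ks)

    encode : ∀ {M} → ℕ → Vec (Fin m) M → Vec (Fin n) (suc M)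
    encode u []       = u mod n ∷ []
    encode u (k ∷ ks) = (u + proj₁ (exponents k)) mod n ∷ encode (proj₂ (exponents k)) ks

    toℕ-encode : ∀ {M} u (ks : Vec (Fin m) M) →
                 map toℕ (toList (encode u ks)) ≡ residues u (map exponents (toList ks))
    toℕ-encode u []       = cong (_∷ []) (toℕ-fromℕ< _)
    toℕ-encode u (k ∷ ks) = cong₂ _∷_ (toℕ-fromℕ< _) (toℕ-encode (proj₂ (exponents k)) ks)

    encode-injective : ∀ {M} → Injective _≡_ _≡_ (encode {M} 0)
    encode-injective {M} {ks} {ks′} eq
      with decipher Y⊆block 0<n 0<n (all-in-Y (toList ks)) (all-in-Y (toList ks′))
             (trans (sym (toℕ-encode 0 ks)) (trans (cong (map toℕ ∘ toList) eq) (toℕ-encode 0 ks′)))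
    ... | inj₁ (_ , eq′) =
      trans (sym (cast-is-id refl ks)) (toList-injective refl ks ks′ (map-injective exponents-injective eq′))
    ... | inj₂ cycle = ⊥-elim (acyclic (subst (λ k → TransClosure (ArrowOf Y) k 0) (x−ₙx≡0 0) cycle))

  ¬ArrowOf-0-0 : ∀ {X} → InBlock n X → ¬ ArrowOf X 0 0
  ¬ArrowOf-0-0 X⊆block (i₁ , j₁ , i₂ , j₂ , Xw₁ , Xw₂ , w₁≢w₂ , 0≡ , 0≡′) =
    w₁≢w₂ (cong₂ aba (−ₙ≡0⇒≡ (proj₁ (InBlock⇒< X⊆block Xw₁)) (proj₁ (InBlock⇒< X⊆block Xw₂)) (sym 0≡))
                     (sym (−ₙ≡0⇒≡ (proj₂ (InBlock⇒< X⊆block Xw₂)) (proj₂ (InBlock⇒< X⊆block Xw₁)) (sym 0≡′))))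

module Composition (A : Set) (a b : A) (a≢b : a ≢ b) (n : ℕ) .{{_ : NonZero n}} where

  open Words A a b
  open WordProperties A a b a≢b
  open Residues n
  open Deciphering A a b a≢b n

  record Coordinates (X : Lang) : Set where
    field
      left right : Fin n → ℕ
      left<n     : ∀ k → left k < n
      right<n    : ∀ k → right k < n
      member     : ∀ k → X (aba (left k) (right k))
      injective  : ∀ {k k′} → aba (left k) (right k) ≡ aba (left k′) (right k′) → k ≡ k′
      locate     : ∀ {i j} → X (aba i j) → ∃ λ k → left k ≡ i × right k ≡ j

    arrow : ∀ {k k′} → k ≢ k′ → ArrowOf X (left k −ₙ left k′) (right k′ −ₙ right k)
    arrow {k} {k′} k≢k′ = left k , right k , left k′ , right k′ , member k , member k′ ,
                          k≢k′ ∘ injective , refl , refl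

    arrow⁻¹ : ∀ {k₁ k₂} → ArrowOf X k₁ k₂ →
              ∃₂ λ k k′ → k ≢ k′ × k₁ ≡ left k −ₙ left k′ × k₂ ≡ right k′ −ₙ right k
    arrow⁻¹ (i₁ , j₁ , i₂ , j₂ , Xw₁ , Xw₂ , w₁≢w₂ , refl , refl) with locate Xw₁ | locate Xw₂
    ... | k , refl , refl | k′ , refl , refl = k , k′ , (λ { refl → w₁≢w₂ refl }) , refl , refl

  coordinates : ∀ {X} → IsCbc n X → Coordinates X
  coordinates {X} (X⊆block , (f , f-injective , f-onto) , _) = record
    { left      = proj₁ ∘ shape
    ; right     = proj₁ ∘ proj₂ ∘ shape
    ; left<n    = proj₁ ∘ proj₂ ∘ proj₂ ∘ shape
    ; right<n   = proj₁ ∘ proj₂ ∘ proj₂ ∘ proj₂ ∘ shape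
    ; member    = λ k → subst X (f≡aba k) (Xf k)
    ; injective = λ {k} {k′} eq → f-injective (trans (f≡aba k) (trans eq (sym (f≡aba k′))))
    ; locate    = locate
    }
    where
    Xf : ∀ k → X (f k)
    Xf k = proj₂ (f-onto (f k)) (k , refl)
    shape = λ k → X⊆block (f k) (Xf k)
    f≡aba : ∀ k → f k ≡ aba (proj₁ (shape k)) (proj₁ (proj₂ (shape k)))
    f≡aba k = proj₂ (proj₂ (proj₂ (proj₂ (shape k))))
    locate : ∀ {i j} → X (aba i j) → ∃ λ k → proj₁ (shape k) ≡ i × proj₁ (proj₂ (shape k)) ≡ j
    locate Xw with proj₁ (f-onto _) Xw
    ... | k , fk≡w = k , aba-injective (trans (sym (f≡aba k)) fk≡w)

  HasCard-from-enumeration : ∀ {Y m} (g : Fin m → Word) → m ≡ n → Injective _≡_ _≡_ g →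
                             (∀ k → Y (g k)) → (∀ {w} → Y w → ∃ λ k → g k ≡ w) → HasCard n Y
  HasCard-from-enumeration g refl g-injective Yg onto =
    g , g-injective , λ w → onto , λ { (k , refl) → Yg k }

  module Pair {Z X : Lang} (Z-cbc : IsCbc n Z) (X-cbc : IsCbc n X) where

    private
      module Z = Coordinates (coordinates Z-cbc)
      module X = Coordinates (coordinates X-cbc)

    -- (z , x) pairs the z-th word of Z with the x-th word of X
    Chain : Set
    Chain = Fin n × Fin n

    _≟ᶜ_ : (c c′ : Chain) → Dec (c ≡ c′)
    _≟ᶜ_ = ≡-dec _≟ᶠ_ _≟ᶠ_

    key : Chain → ℕ
    key (z , x) = (Z.right z + X.left x) % n

    word : Chain → Word
    word (z , x) = aba (Z.left z) (X.right x)

    word-∈ : ∀ {r} c → key c ≡ r → compose n Z r X (word c)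
    word-∈ (z , x) key≡r = Z.left z , Z.right z , X.left x , X.right x , Z.member z , X.member x , key≡r , refl

    ∈⇒word : ∀ {r w} → compose n Z r X w → ∃ λ c → key c ≡ r × word c ≡ w
    ∈⇒word (_ , _ , _ , _ , Zij , Xkl , key≡r , refl) with Z.locate Zij | X.locate Xkl
    ... | z , refl , refl | x , refl , refl = (z , x) , key≡r , refl

    compose⊆block : ∀ r → InBlock n (compose n Z r X)
    compose⊆block r w (i , j , k , l , Zij , Xkl , _ , w≡) =
      i , l , proj₁ (InBlock⇒< (proj₁ Z-cbc) Zij) , proj₂ (InBlock⇒< (proj₁ X-cbc) Xkl) , w≡

    chains : List Chain
    chains = cartesianProduct (allFin n) (allFin n)

    chainsWithKey : ℕ → List Chain
    chainsWithKey = fibre key chains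

    lookup-key : ∀ r p → key (lookup (chainsWithKey r) p) ≡ r
    lookup-key r p = proj₂ (∈-filter⁻ (λ c → key c ≟ r) {xs = chains} (∈-lookup p))

    locate-chain : ∀ {r} c → key c ≡ r → ∃ λ p → lookup (chainsWithKey r) p ≡ c
    locate-chain {r} (z , x) key≡r = index c∈ , sym (lookup-index c∈)
      where
      c∈ = ∈-filter⁺ (λ c → key c ≟ r) (∈-cartesianProduct⁺ (∈-allFin z) (∈-allFin x)) key≡r

    lookup-injective : ∀ r → Injective _≡_ _≡_ (lookup (chainsWithKey r))
    lookup-injective r = Unique⇒lookup-injective
      (Unique.filter⁺ (λ c → key c ≟ r) (Unique.cartesianProduct⁺ (Unique.allFin⁺ n) (Unique.allFin⁺ n)))

    sumBelow-length-chainsWithKey : sumBelow n (λ r → length (chainsWithKey r)) ≡ n * n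
    sumBelow-length-chainsWithKey =
      trans (sumBelow-length-fibre key n (λ { (z , x) → m%n<n _ n }) chains)
            (trans (length-product (allFin n) (allFin n)) (cong₂ _*_ length-allFin length-allFin))
      where
      length-allFin : length (allFin n) ≡ n
      length-allFin = length-tabulate (λ k → k)
      length-product : ∀ {C D : Set} (xs : List C) (ys : List D) →
                       length (cartesianProduct xs ys) ≡ length xs * length ys
      length-product [] ys = refl
      length-product (x ∷ xs) ys = trans (length-++ (map (x ,_) ys))
        (cong₂ _+_ (length-map (x ,_) ys) (length-product xs ys))

    enumerate : ∀ r → Fin (length (chainsWithKey r)) → Word
    enumerate r = word ∘ lookup (chainsWithKey r)

    enumerate-∈ : ∀ r p → compose n Z r X (enumerate r p)
    enumerate-∈ r p = word-∈ (lookup (chainsWithKey r) p) (lookup-key r p)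

    enumerate-onto : ∀ {r w} → compose n Z r X w → ∃ λ p → enumerate r p ≡ w
    enumerate-onto Cw with ∈⇒word Cw
    ... | c , key≡r , refl with locate-chain c key≡r
    ...   | p , refl = p , refl

    key≡key⇒−ₙ≡−ₙ : ∀ {z x z′ x′} → key (z , x) ≡ key (z′ , x′) →
                    Z.right z′ −ₙ Z.right z ≡ X.left x −ₙ X.left x′
    key≡key⇒−ₙ≡−ₙ {z} {x} {z′} {x′} key≡ =
      ≡ₙ⇒−ₙ≡−ₙ (Z.right<n z′) (Z.right<n z) (X.left<n x) (X.left<n x′)
        (trans (sym key≡) (cong (_% n) (+-comm (Z.right z) (X.left x))))

    junction : ∀ {k k′} → ArrowOf Z 0 k → ArrowOf X k k′ →
               ∃₂ λ c c′ → c ≢ c′ × key c ≡ key c′ ×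
                 Z.left (proj₁ c) ≡ Z.left (proj₁ c′) × k′ ≡ X.right (proj₂ c′) −ₙ X.right (proj₂ c)
    junction Zarrow Xarrow with Z.arrow⁻¹ Zarrow | X.arrow⁻¹ Xarrow
    ... | z , z′ , z≢z′ , 0≡ , refl | x , x′ , _ , k≡ , refl =
      (z , x) , (z′ , x′) , (λ { refl → z≢z′ refl }) ,
      trans (cong (_% n) (+-comm (Z.right z) (X.left x)))
            (−ₙ≡−ₙ⇒≡ₙ (X.left<n x) (X.left<n x′) (Z.right<n z′) (Z.right<n z) (sym k≡)) ,
      −ₙ≡0⇒≡ (Z.left<n z) (Z.left<n z′) (sym 0≡) , refl

    extend : ∀ {k k′} → ArrowOf Z 0 k → ArrowOf X k k′ → k′ ≢ 0 →
             ∃ λ r → r < n × ArrowOf (compose n Z r X) 0 k′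
    extend Zarrow Xarrow k′≢0 with junction Zarrow Xarrow
    ... | c@(z , x) , c′@(z′ , x′) , _ , key≡ , left≡ , refl =
      key c , m%n<n _ n ,
      Z.left z , X.right x , Z.left z′ , X.right x′ , word-∈ c refl , word-∈ c′ (sym key≡) ,
      (λ w≡w′ → k′≢0 (trans (cong (X.right x′ −ₙ_) (proj₂ (aba-injective w≡w′))) (x−ₙx≡0 (X.right x′)))) ,
      trans (sym (x−ₙx≡0 (Z.left z))) (cong (Z.left z −ₙ_) left≡) , refl

    module _ {ℓ} {R : ℕ → ℕ → Set ℓ}
             (Z⇒R : ∀ {k₁ k₂} → ArrowOf Z k₁ k₂ → TransClosure R k₁ k₂)
             (X⇒R : ∀ {k₁ k₂} → ArrowOf X k₁ k₂ → TransClosure R k₁ k₂) where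

      chain-path : ∀ {c c′} → c ≢ c′ → key c ≡ key c′ →
                   TransClosure R (Z.left (proj₁ c) −ₙ Z.left (proj₁ c′)) (X.right (proj₂ c′) −ₙ X.right (proj₂ c))
      chain-path {z , x} {z′ , x′} c≢c′ key≡ with z ≟ᶠ z′ | x ≟ᶠ x′
      ... | yes refl | yes refl = ⊥-elim (c≢c′ refl)
      ... | yes refl | no x≢x′ = subst (λ k → TransClosure R k _) start≡ (X⇒R (X.arrow x≢x′))
        where
        start≡ : X.left x −ₙ X.left x′ ≡ Z.left z −ₙ Z.left z
        start≡ = trans (≡⇒−ₙ≡0 (≡ₙ⇒≡ (X.left<n x) (X.left<n x′) (+-cancelˡ-≡ₙ (Z.right z) key≡)))
                       (sym (x−ₙx≡0 (Z.left z)))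
      ... | no z≢z′ | yes refl = subst (TransClosure R _) end≡ (Z⇒R (Z.arrow z≢z′))
        where
        end≡ : Z.right z′ −ₙ Z.right z ≡ X.right x −ₙ X.right x
        end≡ = trans (≡⇒−ₙ≡0 (≡ₙ⇒≡ (Z.right<n z′) (Z.right<n z) (+-cancelʳ-≡ₙ (X.left x) (sym key≡))))
                     (sym (x−ₙx≡0 (X.right x)))
      ... | no z≢z′ | no x≢x′ =
        Z⇒R (Z.arrow z≢z′) ++⁺ subst (λ k → TransClosure R k _) (sym (key≡key⇒−ₙ≡−ₙ key≡)) (X⇒R (X.arrow x≢x′))

      compose-arrow⇒path : ∀ {r k₁ k₂} → ArrowOf (compose n Z r X) k₁ k₂ → TransClosure R k₁ k₂
      compose-arrow⇒path (_ , _ , _ , _ , Cw₁ , Cw₂ , w₁≢w₂ , refl , refl) with ∈⇒word Cw₁ | ∈⇒word Cw₂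
      ... | c , key≡r , w₁≡ | c′ , key′≡r , w₂≡ with aba-injective w₁≡ | aba-injective w₂≡
      ...   | refl , refl | refl , refl =
        chain-path (λ { refl → w₁≢w₂ refl }) (trans key≡r (sym key′≡r))

      module _ (acyclic : ¬ TransClosure R 0 0) where

        compose-acyclic : ∀ r → ¬ TransClosure (ArrowOf (compose n Z r X)) 0 0
        compose-acyclic r = acyclic ∘ concatMap⁺ compose-arrow⇒path

        enumerate-injective : ∀ r → Injective _≡_ _≡_ (enumerate r)
        enumerate-injective r {p} {q} w≡w′ with lookup (chainsWithKey r) p ≟ᶜ lookup (chainsWithKey r) q
        ... | yes c≡c′ = lookup-injective r c≡c′
        ... | no  c≢c′ with aba-injective w≡w′
        ...   | left≡ , right≡ = ⊥-elim (acyclic (subst₂ (TransClosure R)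
                  (trans (cong (Z.left z −ₙ_) (sym left≡)) (x−ₙx≡0 (Z.left z)))
                  (trans (cong (X.right x′ −ₙ_) right≡) (x−ₙx≡0 (X.right x′)))
                  (chain-path c≢c′ (trans (lookup-key r p) (sym (lookup-key r q))))))
          where
          z = proj₁ (lookup (chainsWithKey r) p)
          x′ = proj₂ (lookup (chainsWithKey r) q)

        length-chainsWithKey≤n : ∀ r → length (chainsWithKey r) ≤ n
        length-chainsWithKey≤n r =
          kraft (compose⊆block r) (compose-acyclic r) (enumerate r) (enumerate-injective r) (enumerate-∈ r)

        -- all n fibres are at most n long and together n² long
        length-chainsWithKey≡n : ∀ {r} → r < n → length (chainsWithKey r) ≡ n
        length-chainsWithKey≡n {r} r<n = ≤-antisym (length-chainsWithKey≤n r) (≮⇒≥ λ length<n →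
          <-irrefl (trans sumBelow-length-chainsWithKey (sym (sumBelow-const n n)))
                   (sumBelow-mono-< n (λ r _ → length-chainsWithKey≤n r) r<n length<n))

        compose-isCbc : ∀ {r} → r < n → IsCbc n (compose n Z r X)
        compose-isCbc {r} r<n =
          compose⊆block r ,
          HasCard-from-enumeration (enumerate r) (length-chainsWithKey≡n r<n)
            (enumerate-injective r) (enumerate-∈ r) enumerate-onto ,
          isCode-addAn (compose⊆block r) (compose-acyclic r)

    module _ (cards : ∀ r → r < n → HasCard n (compose n Z r X)) where

      private
        module Card {r} (r<n : r < n) where
          f : Fin n → Word
          f = proj₁ (cards r r<n)
          f-injective : Injective _≡_ _≡_ f
          f-injective = proj₁ (proj₂ (cards r r<n))
          cover : ∀ k → ∃ λ p → enumerate r p ≡ f k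
          cover k = enumerate-onto (proj₂ (proj₂ (proj₂ (cards r r<n)) (f k)) (k , refl))

      n≤length-chainsWithKey : ∀ r → r < n → n ≤ length (chainsWithKey r)
      n≤length-chainsWithKey r r<n = cover⇒≤ (enumerate r) (Card.f-injective r<n) (Card.cover r<n)

      -- the two chains of a junction give the same word, so one fibre exceeds n
      no-return : ∀ {k} → ArrowOf Z 0 k → ArrowOf X k 0 → ⊥
      no-return Zarrow Xarrow with junction Zarrow Xarrow
      ... | c@(z , x) , c′@(z′ , x′) , c≢c′ , key≡ , left≡ , 0≡ =
        <-irrefl (trans (sumBelow-const n n) (sym sumBelow-length-chainsWithKey))
                 (sumBelow-mono-< n n≤length-chainsWithKey r<n n<length)
        where
        r<n = m%n<n (Z.right z + X.left x) n
        p  = proj₁ (locate-chain c refl)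
        p′ = proj₁ (locate-chain c′ (sym key≡))
        p≢p′ : p ≢ p′
        p≢p′ p≡p′ = c≢c′ (trans (sym (proj₂ (locate-chain c refl)))
                      (trans (cong (lookup (chainsWithKey (key c))) p≡p′) (proj₂ (locate-chain c′ (sym key≡)))))
        same-word : enumerate (key c) p ≡ enumerate (key c) p′
        same-word = begin
          enumerate (key c) p   ≡⟨ cong word (proj₂ (locate-chain c refl)) ⟩
          word c                ≡⟨ cong₂ aba left≡ (sym (−ₙ≡0⇒≡ (X.right<n x′) (X.right<n x) (sym 0≡))) ⟩
          word c′               ≡⟨ cong word (proj₂ (locate-chain c′ (sym key≡))) ⟨
          enumerate (key c) p′  ∎
          where open ≡-Reasoning
        n<length : n < length (chainsWithKey (key c))
        n<length = cover-collision⇒< (enumerate (key c)) (Card.f-injective r<n) (Card.cover r<n) p≢p′ same-word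

module Theorem (A : Set) (a b : A) (a≢b : a ≢ b) (n : ℕ) .{{_ : NonZero n}}
               (E : Words.Lang A a b → Set) (E-cbc : Words.SetOfCbc A a b n E) where

  open Words A a b
  open Deciphering A a b a≢b n
  open Composition A a b a≢b n

  Steps : List (ℕ × Lang) → Set₁
  Steps = All (λ rX → proj₁ rX < n × E (proj₂ rX))

  compatible-if-acyclic : ¬ HasNonemptyCycleAt0 n E → Compatible n E
  compatible-if-acyclic acyclic X₁ rs EX₁ steps = go rs (E-cbc X₁ EX₁) (λ arrow → [ X₁ , EX₁ , arrow ]⁺) steps
    where
    go : ∀ rs {Z} → IsCbc n Z → (∀ {k₁ k₂} → ArrowOf Z k₁ k₂ → TransClosure (Arrow n E) k₁ k₂) →
         Steps rs → IsCbc n (composeAll n Z rs)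
    go []             Z-cbc _   []                = Z-cbc
    go ((r , X) ∷ rs) Z-cbc Z⇒G ((r<n , EX) ∷ steps) =
      go rs (ZX.compose-isCbc Z⇒G X⇒G acyclic r<n) (ZX.compose-arrow⇒path Z⇒G X⇒G) steps
      where
      X-cbc = E-cbc X EX
      module ZX = Pair Z-cbc X-cbc
      X⇒G : ∀ {k₁ k₂} → ArrowOf X k₁ k₂ → TransClosure (Arrow n E) k₁ k₂
      X⇒G arrow = [ X , EX , arrow ]⁺

  composeAll-∷ʳ : ∀ X₁ rs r X → composeAll n X₁ (rs ++ [ (r , X) ]) ≡ compose n (composeAll n X₁ rs) r X
  composeAll-∷ʳ X₁ rs r X = foldl-++ _ X₁ rs [ (r , X) ]

  module _ (compatible : Compatible n E) where

    -- a path 0 → k in 𝒢ₙ(E) is realised as one arrow 0 → k of a composition, which cannot return to 0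
    no-return-path : ∀ X₁ rs → E X₁ → Steps rs → ∀ {k} → ArrowOf (composeAll n X₁ rs) 0 k →
                     ¬ TransClosure (Arrow n E) k 0
    no-return-path X₁ rs EX₁ steps Zarrow [ X , EX , Xarrow ]⁺ =
      Pair.no-return (compatible X₁ rs EX₁ steps) (E-cbc X EX) cards Zarrow Xarrow
      where
      cards : ∀ r → r < n → HasCard n (compose n (composeAll n X₁ rs) r X)
      cards r r<n = subst (HasCard n) (composeAll-∷ʳ X₁ rs r X)
        (proj₁ (proj₂ (compatible X₁ (rs ++ [ (r , X) ]) EX₁ (All.++⁺ steps ((r<n , EX) ∷ [])))))
    no-return-path X₁ rs EX₁ steps Zarrow (_∷_ {y = k′} (X , EX , Xarrow) path) with k′ ≟ 0
    ... | yes refl = no-return-path X₁ rs EX₁ steps Zarrow [ X , EX , Xarrow ]⁺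
    ... | no k′≢0 with Pair.extend (compatible X₁ rs EX₁ steps) (E-cbc X EX) Zarrow Xarrow k′≢0
    ...   | r , r<n , Carrow = no-return-path X₁ (rs ++ [ (r , X) ]) EX₁ (All.++⁺ steps ((r<n , EX) ∷ []))
                                 (subst (λ C → ArrowOf C 0 k′) (sym (composeAll-∷ʳ X₁ rs r X)) Carrow) path

    acyclic-if-compatible : ¬ HasNonemptyCycleAt0 n E
    acyclic-if-compatible [ X , EX , arrow ]⁺      = ¬ArrowOf-0-0 (proj₁ (E-cbc X EX)) arrow
    acyclic-if-compatible ((X , EX , arrow) ∷ path) = no-return-path X [] EX [] arrow path

mainTheorem9 : (A : Set) (a b : A) → a ≢ b → (n : ℕ) .{{_ : NonZero n}} →
    (E : Words.Lang A a b → Set) → Words.SetOfCbc A a b n E →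
    (Words.Compatible A a b n E → ¬ Words.HasNonemptyCycleAt0 A a b n E) ×
    (¬ Words.HasNonemptyCycleAt0 A a b n E → Words.Compatible A a b n E)
mainTheorem9 A a b a≢b n E E-cbc =
  Theorem.acyclic-if-compatible A a b a≢b n E E-cbc , Theorem.compatible-if-acyclic A a b a≢b n E E-cbc
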